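{- Let $\mathbb{K}$ be a field, $M\geqslant 2$ an integer, and let $x_0,x_1,\ldots,x_M$ be points of $\mathrm{PG}_M(\mathbb{K})$ in general position. Put $\Sigma_i=x_0\oplus\cdots\oplus x_i$ and $\pi_i=x_1\oplus\cdots\oplus x_i$. For $i=3,\ldots,M$ let $y_i$ be a point of the line $x_{i-1}\oplus x_i$ distinct from $x_{i-1},x_i$. Let $L$ be a finite set of lines of $\Sigma_2$, none equal to $\pi_2$, meeting $\pi_2$ in pairwise distinct points of $\pi_2\setminus\{x_2\}$, labelled $\ell_{(1)},\ldots,\ell_{(|L|)}$, and for ordered subsets $J=(\ldots,b,a)$ of $\{1,\ldots,|L|\}$ with $2\leqslant|J|\leqslant M-1$ define recursively $\ell_J=(x_{|J|+1}\oplus \ell_{J\setminus\{a\}})\cap(y_{|J|+1}\oplus \ell_{J\setminus\{b\}})$. Let $m$ be a line of $\Sigma_2$ through $x_2$ with $m\neq\pi_2$. For disjoint ordered subsets $J=(a_1,\ldots,a_j)$ and $\overline{J}=(\overline{a}_1,\ldots,\overline{a}_j)$ of $\{1,\ldots,|L|\}$ of the same size $j$, $1\leqslant j\leqslant M-1$, such that $\ell_{(a_i)}\cap\ell_{(\overline{a}_i)}\cap m$ is a point for every $i$, define the point $z_{J,\overline{J},m}$ by $z_{(a_1),(\overline{a}_1),m}=\ell_{(a_1)}\cap\ell_{(\overline{a}_1)}\cap m$ if $j=1$, and, if $j\geqslant 2$, writing $J=(\ldots,b,a)$ and $\overline{J}=(\ldots,\overline{b},\overline{a})$, $$z_{J,\overline{J},m}=(x_{j+1}\oplus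 z_{J\setminus\{a\},\overline{J}\setminus\{\overline{a}\},m})\cap(y_{j+1}\oplus z_{J\setminus\{b\},\overline{J}\setminus\{\overline{b}\},m}).$$ Then the point $z_{J,\overline{J},m}$ is incident with the line $\ell_J$.
   Context: For non-intersecting subspaces $x,y$ of a projective space, $x\oplus y$ denotes the subspace they span. An ordered subset of $\{1,\ldots,|L|\}$ is a finite sequence of pairwise distinct elements; $J\setminus\{a\}$ is obtained by deleting the entry $a$ and keeping the order of the remaining entries; for $J=(i)$, $\ell_J=\ell_{(i)}$. -}

module Defs where

open import Level using (Level; _⊔_) renaming (suc to lsuc)
open import Algebra.Bundles using (CommutativeRing)
open import Data.Nat using (ℕ; zero; suc; _<?_)
open import Data.Fin using (Fin; fromℕ<) renaming (zero to fz; suc to fs)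
open import Data.Vec using (Vec; []; _∷_; init)
open import Data.Product using (Σ; ∃; ∃₂; _×_; _,_)
open import Relation.Nullary using (¬_; yes; no)

record Field (c ℓ : Level) : Set (lsuc (c ⊔ ℓ)) where
  field
    commRing : CommutativeRing c ℓ
  open CommutativeRing commRing public hiding (ring)
  field
    1≉0     : ¬ (1# ≈ 0#)
    inverse : ∀ x → ¬ (x ≈ 0#) → ∃ λ y → (x * y) ≈ 1#

-- Deleting the penultimate entry of a vector of length ≥ 2
-- (J = (…, b, a)  ↦  J ∖ {b}).
delPenult : ∀ {a} {A : Set a} {n} → Vec A (suc (suc n)) → Vec A (suc n)
delPenult {n = zero} (b ∷ a ∷ []) = a ∷ []
delPenult {n = suc n} (c ∷ J) = c ∷ delPenult J

-- Projective geometry of PG_M(K), modelled on the vector space K^(M+1).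
-- A subspace of PG_M(K) is represented by the corresponding (predicate on
-- vectors of) linear subspace of K^(M+1).
module Proj {c ℓ} (F : Field c ℓ) (M : ℕ) where
  open Field F

  V : Set c
  V = Fin (suc M) → Carrier

  _≈ᵛ_ : V → V → Set ℓ
  u ≈ᵛ w = ∀ k → u k ≈ w k

  0ᵛ : V
  0ᵛ _ = 0#

  _+ᵛ_ : V → V → V
  (u +ᵛ w) k = u k + w k

  _·_ : Carrier → V → V
  (a · u) k = a * u k

  lincomb : ∀ {n} → (Fin n → Carrier) → (Fin n → V) → V
  lincomb {zero} a u = 0ᵛ
  lincomb {suc n} a u = (a fz · u fz) +ᵛ lincomb (λ i → a (fs i)) (λ i → u (fs i))

  Independent : ∀ {n} → (Fin n → V) → Set (c ⊔ ℓ)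
  Independent {n} u = ∀ (a : Fin n → Carrier) → lincomb a u ≈ᵛ 0ᵛ → ∀ i → a i ≈ 0#

  Sub : Set (lsuc (c ⊔ ℓ))
  Sub = V → Set (c ⊔ ℓ)

  span : ∀ {n} → (Fin n → V) → Sub
  span {n} u v = ∃ λ (a : Fin n → Carrier) → v ≈ᵛ lincomb a u

  ⟨_⟩ : V → Sub
  ⟨ u ⟩ v = ∃ λ a → v ≈ᵛ (a · u)

  _⊕_ : Sub → Sub → Sub
  (S ⊕ T) v = ∃₂ λ s t → S s × T t × v ≈ᵛ (s +ᵛ t)

  _∩_ : Sub → Sub → Sub
  (S ∩ T) v = S v × T v

  infixl 6 _⊕_
  infixl 7 _∩_

  _⊆_ : Sub → Sub → Set (c ⊔ ℓ)
  S ⊆ T = ∀ v → S v → T v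

  _≐_ : Sub → Sub → Set (c ⊔ ℓ)
  S ≐ T = (S ⊆ T) × (T ⊆ S)

  two : V → V → Fin 2 → V
  two u w fz = u
  two u w (fs _) = w

  IsPoint : Sub → Set (c ⊔ ℓ)
  IsPoint S = ∃ λ u → ¬ (u ≈ᵛ 0ᵛ) × S ≐ ⟨ u ⟩

  IsLine : Sub → Set (c ⊔ ℓ)
  IsLine S = ∃₂ λ u w → Independent (two u w) × S ≐ span (two u w)

  -- extend a family indexed by {0,…,M} to ℕ (values beyond M are never used)
  ext : (Fin (suc M) → V) → ℕ → V
  ext x k with k <? suc M
  ... | yes p = x (fromℕ< p)
  ... | no _ = 0ᵛ

  module Config (x y : Fin (suc M) → V) {N : ℕ} (L : Fin N → Sub) (m : Sub) where
    X Y : ℕ → V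
    X = ext x
    Y = ext y

    -- ℓ_J for an ordered subset J of length n+1; ℓ_(a) = L a and, for
    -- J = (…,b,a) with |J| = n+2,
    -- ℓ_J = (x_{|J|+1} ⊕ ℓ_{J∖a}) ∩ (y_{|J|+1} ⊕ ℓ_{J∖b})
    ℓJ : ∀ {n} → Vec (Fin N) (suc n) → Sub
    ℓJ {zero} (a ∷ []) = L a
    ℓJ {suc n} J =
      (⟨ X (suc (suc (suc n))) ⟩ ⊕ ℓJ (init J)) ∩ (⟨ Y (suc (suc (suc n))) ⟩ ⊕ ℓJ (delPenult J))

    zJ : ∀ {n} → Vec (Fin N) (suc n) → Vec (Fin N) (suc n) → Sub
    zJ {zero} (a ∷ []) (a' ∷ []) = L a ∩ L a' ∩ m
    zJ {suc n} J J' =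
      (⟨ X (suc (suc (suc n))) ⟩ ⊕ zJ (init J) (init J'))
        ∩ (⟨ Y (suc (suc (suc n))) ⟩ ⊕ zJ (delPenult J) (delPenult J'))

  three : V → V → V → Fin 3 → V
  three u v w fz = u
  three u v w (fs fz) = v
  three u v w (fs (fs _)) = w

  Σ₂ : (Fin (suc M) → V) → Sub
  Σ₂ x = span (three (ext x 0) (ext x 1) (ext x 2))

  π₂ : (Fin (suc M) → V) → Sub
  π₂ x = span (two (ext x 1) (ext x 2))

module Submission where

-- The points z_{J,J̄,m} and the lines ℓ_J are built by the
-- same recursion: both are obtained from their two predecessors (indexed by
-- J∖{a} and J∖{b}) by joining with x_{j+1}, resp. y_{j+1}, and intersecting.
-- Joining with a fixed subspace and intersecting are monotone with respect
-- to incidence, so incidence of the predecessors propagates to the new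
-- object.  At the base, z_{(a),(ā),m} = ℓ_(a) ∩ ℓ_(ā) ∩ m lies on ℓ_(a).
-- Hence z_{J,J̄,m} ⊆ ℓ_J by induction on |J|.
--
-- The
-- general-position hypotheses of the lemma only guarantee that the
-- objects involved are genuine points and lines; incidence does not need them.

open import Defs
open import Level using (Level)
open import Data.Nat using (ℕ; zero; suc; _≤_; _∸_)
open import Data.Fin using (Fin)
open import Data.Vec using (Vec; []; _∷_; init; lookup; toList)
open import Data.List.Relation.Unary.Unique.Propositional using (Unique)
open import Data.Product using (_×_; _,_; proj₁)
open import Relation.Nullary using (¬_)
open import Relation.Binary.PropositionalEquality using (_≢_)

module Incidence {c ℓ : Level} (F : Field c ℓ) (M : ℕ) where
  open Proj F M

  ⊕-monoʳ : ∀ {P S T : Sub} → S ⊆ T → (P ⊕ S) ⊆ (P ⊕ T)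
  ⊕-monoʳ S⊆T v (s , t , Ps , St , v≈s+t) = s , t , Ps , S⊆T t St , v≈s+t

  ∩-mono : ∀ {S S' T T' : Sub} → S ⊆ S' → T ⊆ T' → (S ∩ T) ⊆ (S' ∩ T')
  ∩-mono S⊆S' T⊆T' v (Sv , Tv) = S⊆S' v Sv , T⊆T' v Tv

  ∩-⊆ˡ : ∀ {S T : Sub} → (S ∩ T) ⊆ S
  ∩-⊆ˡ v = proj₁

  module _ (x y : Fin (suc M) → V) {N : ℕ} (L : Fin N → Sub) (m : Sub) where
    open Config x y L m

    zJ⊆ℓJ : ∀ {n} (J J' : Vec (Fin N) (suc n)) → zJ J J' ⊆ ℓJ J
    zJ⊆ℓJ {zero} (a ∷ []) (a' ∷ []) v z =
      ∩-⊆ˡ {L a} {L a'} v (∩-⊆ˡ {L a ∩ L a'} {m} v z)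
    zJ⊆ℓJ {suc n} J J' =
      ∩-mono (⊕-monoʳ (zJ⊆ℓJ (init J) (init J')))
             (⊕-monoʳ (zJ⊆ℓJ (delPenult J) (delPenult J')))

lemma2p4 : ∀ {c ℓ : Level} (F : Field c ℓ) (M : ℕ) → 2 ≤ M →
    let open Proj F M in
    (x : Fin (suc M) → V) → Independent x →
    (y : Fin (suc M) → V) →
    (∀ i → 3 ≤ i → i ≤ M →
      ¬ (ext y i ≈ᵛ 0ᵛ) × (⟨ ext y i ⟩ ⊆ (⟨ ext x (i ∸ 1) ⟩ ⊕ ⟨ ext x i ⟩))
        × ¬ (⟨ ext y i ⟩ ≐ ⟨ ext x (i ∸ 1) ⟩) × ¬ (⟨ ext y i ⟩ ≐ ⟨ ext x i ⟩)) →
    (N : ℕ) (L : Fin N → Sub) →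
    (∀ a → IsLine (L a) × (L a ⊆ Σ₂ x) × ¬ (L a ≐ π₂ x) × IsPoint (L a ∩ π₂ x)
             × ¬ ((L a ∩ π₂ x) ≐ ⟨ ext x 2 ⟩)) →
    (∀ a b → a ≢ b → ¬ ((L a ∩ π₂ x) ≐ (L b ∩ π₂ x))) →
    (m : Sub) → IsLine m → m ⊆ Σ₂ x → ⟨ ext x 2 ⟩ ⊆ m → ¬ (m ≐ π₂ x) →
    (n : ℕ) → suc n ≤ M ∸ 1 →
    (J J' : Vec (Fin N) (suc n)) →
    Unique (toList J) → Unique (toList J') →
    (∀ i k → lookup J i ≢ lookup J' k) →
    (∀ i → IsPoint (L (lookup J i) ∩ L (lookup J' i) ∩ m)) →
    Config.zJ x y L m J J' ⊆ Config.ℓJ x y L m J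
lemma2p4 F M _ x _ y _ N L _ _ m _ _ _ _ _ _ J J' _ _ _ _ =
  Incidence.zJ⊆ℓJ F M x y L m J J'
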